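{- Let $k\geq 3$ be odd and let $a,b,c,d\in\mathbb{Z}D_{2k}$ have all coefficients in $\{0,1\}$. For $w\in\{a,b,c,d\}$ put $W^{\rho}=2\rho(w)-J_{2k}$ and $W^{\lambda}=2\lambda(w)-J_{2k}$. Then the four matrices $A^\rho,B^\rho,C^\rho,D^\rho$ satisfy the system \[ \begin{aligned} AA^\intercal + BB^\intercal + CC^\intercal + DD^\intercal &= (8k+4)I_{2k} - 4J_{2k},\\ -AB^\intercal +BA^\intercal + CD^\intercal- DC^\intercal &= 0,\\ -AC^\intercal - BD^\intercal + CA^\intercal +DB^\intercal &= 0,\\ AD^\intercal - BC^\intercal+ CB^\intercal - DA^\intercal &=0 \end{aligned} \] if and only if $A^\lambda,B^\lambda,C^\lambda,D^\lambda$ satisfy the same system. Moreover, if $H_1$ and $H_2$ denote the Kimura Hadamard matrices obtained by inserting $A^\rho,B^\rho,C^\rho,D^\rho$, respectively $A^\lambda,B^\lambda,C^\lambda,D^\lambda$, as the blocks $A,B,C,D$ of the Kimura template, then $RH_1R^\intercal=H_2$, where $R=\mathrm{diag}(1,1,1,1,Q,Q,Q,Q)$, $Q=\mathrm{diag}(P,I_k)$, and $P$ is the $k\times k$ permutation matrix of the permutation $(2,k)(3,k-1)\cdots(\tfrac{k+1}{2},\tfrac{k+3}{2})$.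
   Context: $D_{2k}=\langle x,y\mid x^k=1,\ y^2=1,\ y^{ -1}xy=x^{ -1}\rangle$ is the dihedral group of order $2k$, with elements listed in the fixed order $x^0,x^1,\dots,x^{k-1},y,xy,\dots,x^{k-1}y$; $2k\times 2k$ matrices have rows and columns indexed by $D_{2k}$ in this order (so indices $1,\dots,k$ correspond to $x^0,\dots,x^{k-1}$). The right and left regular matrix representations are $\rho(g)=[\delta_{ug,v}]_{u,v}$ and $\lambda(g)=[\delta_{g^{ -1}u,v}]_{u,v}$ ($\delta$ the Kronecker delta), both extended $\mathbb{Z}$-linearly to the group ring $\mathbb{Z}D_{2k}$. $J_{2k}$ is the $2k\times 2k$ all-ones matrix. The Kimura template with blocks $A,B,C,D$ (each $2k\times 2k$) is the $(8k+4)\times(8k+4)$ matrix \[ \begin{bmatrix} 1& 1 & 1 & 1 & \mathbf{1} & \mathbf{1} & \mathbf{1} & \mathbf{1}\\ 1& 1 & -1 & -1 & \mathbf{1} & \mathbf{1} & -\mathbf{1} & -\mathbf{1}\\ 1& -1 & 1 & -1 & \mathbf{1} & -\mathbf{1} & \mathbf{1} & -\mathbf{1}\\ 1& -1 & -1 & 1 & -\mathbf{1} & \mathbf{1} & \mathbf{1} & -\mathbf{1}\\ \mathbf{1}^\intercal & \mathbf{1}^\intercal & \mathbf{1}^\intercal & -\mathbf{1}^\intercal & A & B& C & D\\ \mathbf{1}^\intercal & \mathbf{1}^\intercal& -\mathbf{1}^\intercal & \mathbf{1}^\intercal & -B & A & D & -C\\ \mathbf{1}^\intercal & -\mathbf{1}^\intercal&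 \mathbf{1}^\intercal & \mathbf{1}^\intercal & -C & -D & A & B\\ \mathbf{1}^\intercal & -\mathbf{1}^\intercal& -\mathbf{1}^\intercal & -\mathbf{1}^\intercal & D & -C & B & -A \end{bmatrix}, \] where $\mathbf{1}$ is the all-ones row vector of length $2k$; it is a Kimura Hadamard matrix when it is Hadamard, i.e. $HH^\intercal=(8k+4)I_{8k+4}$. $\mathrm{diag}(\cdot)$ denotes a block diagonal matrix. -}

module Defs where

open import Data.Nat as ℕ using (ℕ; zero; suc; NonZero)
open import Data.Nat.DivMod using (_mod_)
open import Data.Integer as ℤ using (ℤ; +_; 0ℤ; 1ℤ; -1ℤ)
open import Data.Fin as Fin using (Fin; zero; suc; toℕ; splitAt; remQuot; join)
open import Data.Fin.Properties using (_≟_)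
open import Data.Sum using (_⊎_; inj₁; inj₂)
open import Data.Product using (_×_; _,_; ∃-syntax)
open import Data.Bool using (Bool; true; false; if_then_else_)
open import Data.Vec using (Vec; []; _∷_; lookup)
open import Relation.Binary.PropositionalEquality using (_≡_)
open import Relation.Nullary.Decidable using (⌊_⌋)

Mat : ℕ → Set
Mat n = Fin n → Fin n → ℤ

∑ : ∀ n → (Fin n → ℤ) → ℤ
∑ zero    f = 0ℤ
∑ (suc n) f = f zero ℤ.+ ∑ n (λ i → f (suc i))

infixl 7 _·_
_·_ : ∀ {n} → Mat n → Mat n → Mat n
(M · N) i j = ∑ _ (λ l → M i l ℤ.* N l j)

_ᵀ : ∀ {n} → Mat n → Mat n
(M ᵀ) i j = M j i

infixl 6 _⊕_ _⊖_
_⊕_ : ∀ {n} → Mat n → Mat n → Mat n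
(M ⊕ N) i j = M i j ℤ.+ N i j

_⊖_ : ∀ {n} → Mat n → Mat n → Mat n
(M ⊖ N) i j = M i j ℤ.- N i j

infixl 7 _⊛_
_⊛_ : ∀ {n} → ℤ → Mat n → Mat n
(c ⊛ M) i j = c ℤ.* M i j

δ : ∀ {n} → Fin n → Fin n → ℤ
δ u v = if ⌊ u ≟ v ⌋ then 1ℤ else 0ℤ

I : ∀ n → Mat n
I n = δ

Jm : ∀ n → Mat n
Jm n _ _ = 1ℤ

Zero : ∀ n → Mat n
Zero n _ _ = 0ℤ

infix 4 _≈_
_≈_ : ∀ {n} → Mat n → Mat n → Set
M ≈ N = ∀ i j → M i j ≡ N i j

-- The dihedral group D_{2k} = ⟨x,y | x^k, y^2, y⁻¹xy = x⁻¹⟩,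
-- elements x^0..x^{k-1}, y, xy, .., x^{k-1}y, indexed by Fin (k + k)
-- in this order: index i < k is x^i, index k + i is x^i y.

module Dihedral (k : ℕ) .{{_ : NonZero k}} where

  G : Set
  G = Fin (k ℕ.+ k)

  elt : ℕ → Bool → G
  elt e false = join k k (inj₁ (e mod k))
  elt e true  = join k k (inj₂ (e mod k))

  -- (x^i y^s)(x^j y^t) = x^(i ± j) y^(s xor t), using y x^j = x^(-j) y
  _∙_ : G → G → G
  g ∙ h with splitAt k g | splitAt k h
  ... | inj₁ i | inj₁ j = elt (toℕ i ℕ.+ toℕ j) false
  ... | inj₁ i | inj₂ j = elt (toℕ i ℕ.+ toℕ j) true
  ... | inj₂ i | inj₁ j = elt (toℕ i ℕ.+ (k ℕ.∸ toℕ j)) true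
  ... | inj₂ i | inj₂ j = elt (toℕ i ℕ.+ (k ℕ.∸ toℕ j)) false

  inv : G → G
  inv g with splitAt k g
  ... | inj₁ i = elt (k ℕ.∸ toℕ i) false
  ... | inj₂ i = g

  ZG : Set
  ZG = G → ℤ

  ρ : G → Mat (k ℕ.+ k)
  ρ g u v = δ (u ∙ g) v

  λ' : G → Mat (k ℕ.+ k)
  λ' g u v = δ (inv g ∙ u) v

  ρZ : ZG → Mat (k ℕ.+ k)
  ρZ w u v = ∑ _ (λ g → w g ℤ.* ρ g u v)

  λZ : ZG → Mat (k ℕ.+ k)
  λZ w u v = ∑ _ (λ g → w g ℤ.* λ' g u v)

System : (k : ℕ) → (A B C D : Mat (k ℕ.+ k)) → Set
System k A B C D =
    (A · A ᵀ ⊕ B · B ᵀ ⊕ C · C ᵀ ⊕ D · D ᵀ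
       ≈ (+ (8 ℕ.* k ℕ.+ 4)) ⊛ I (k ℕ.+ k) ⊖ (+ 4) ⊛ Jm (k ℕ.+ k))
  × (Zero _ ⊖ A · B ᵀ ⊕ B · A ᵀ ⊕ C · D ᵀ ⊖ D · C ᵀ ≈ Zero _)
  × (Zero _ ⊖ A · C ᵀ ⊖ B · D ᵀ ⊕ C · A ᵀ ⊕ D · B ᵀ ≈ Zero _)
  × (A · D ᵀ ⊖ B · C ᵀ ⊕ C · B ᵀ ⊖ D · A ᵀ ≈ Zero _)

-- The Kimura template, of size 4 + 4·n (n = 2k), indices ordered as in
-- the paper: 4 scalar rows/cols, then 4 consecutive blocks of size n.

private
  v4 : ℤ → ℤ → ℤ → ℤ → Vec ℤ 4
  v4 a b c d = a ∷ b ∷ c ∷ d ∷ []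

T₀ : Vec (Vec ℤ 4) 4
T₀ = v4 1ℤ 1ℤ 1ℤ 1ℤ ∷ v4 1ℤ 1ℤ -1ℤ -1ℤ ∷ v4 1ℤ -1ℤ 1ℤ -1ℤ ∷ v4 1ℤ -1ℤ -1ℤ 1ℤ ∷ []

-- top-right: row r, column block c (sign of the all-ones row vector)
T₁ : Vec (Vec ℤ 4) 4
T₁ = v4 1ℤ 1ℤ 1ℤ 1ℤ ∷ v4 1ℤ 1ℤ -1ℤ -1ℤ ∷ v4 1ℤ -1ℤ 1ℤ -1ℤ ∷ v4 -1ℤ 1ℤ 1ℤ -1ℤ ∷ []

-- bottom-left: row block r, column c (sign of the all-ones column vector)
T₂ : Vec (Vec ℤ 4) 4
T₂ = v4 1ℤ 1ℤ 1ℤ -1ℤ ∷ v4 1ℤ 1ℤ -1ℤ 1ℤ ∷ v4 1ℤ -1ℤ 1ℤ 1ℤ ∷ v4 1ℤ -1ℤ -1ℤ -1ℤ ∷ []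

-- bottom-right: sign of the block in block position (r , c)
T₃ : Vec (Vec ℤ 4) 4
T₃ = v4 1ℤ 1ℤ 1ℤ 1ℤ ∷ v4 -1ℤ 1ℤ 1ℤ -1ℤ ∷ v4 -1ℤ -1ℤ 1ℤ 1ℤ ∷ v4 1ℤ -1ℤ 1ℤ -1ℤ ∷ []

-- which of A,B,C,D (0,1,2,3) sits in block position (r , c)
Blk : Vec (Vec (Fin 4) 4) 4
Blk = (f0 ∷ f1 ∷ f2 ∷ f3 ∷ []) ∷ (f1 ∷ f0 ∷ f3 ∷ f2 ∷ []) ∷ (f2 ∷ f3 ∷ f0 ∷ f1 ∷ [])
    ∷ (f3 ∷ f2 ∷ f1 ∷ f0 ∷ []) ∷ []
  where
  f0 f1 f2 f3 : Fin 4
  f0 = zero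
  f1 = suc zero
  f2 = suc (suc zero)
  f3 = suc (suc (suc zero))

_!_!_ : ∀ {A : Set} → Vec (Vec A 4) 4 → Fin 4 → Fin 4 → A
T ! r ! c = lookup (lookup T r) c

pick : ∀ {n} → Mat n → Mat n → Mat n → Mat n → Fin 4 → Mat n
pick A B C D zero = A
pick A B C D (suc zero) = B
pick A B C D (suc (suc zero)) = C
pick A B C D (suc (suc (suc zero))) = D

kimura : ∀ n → (A B C D : Mat n) → Mat (4 ℕ.+ 4 ℕ.* n)
kimura n A B C D i j with splitAt 4 i | splitAt 4 j
... | inj₁ r | inj₁ c = T₀ ! r ! c
... | inj₁ r | inj₂ j' with remQuot {4} n j'
...   | (c , _) = T₁ ! r ! c
kimura n A B C D i j | inj₂ i' | inj₁ c with remQuot {4} n i'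
...   | (r , _) = T₂ ! r ! c
kimura n A B C D i j | inj₂ i' | inj₂ j' with remQuot {4} n i' | remQuot {4} n j'
...   | (r , u) | (c , v) = T₃ ! r ! c ℤ.* pick A B C D (Blk ! r ! c) u v

IsHadamard : ∀ {m} → Mat m → Set
IsHadamard {m} H = H · H ᵀ ≈ (+ m) ⊛ I m

-- the permutation (2,k)(3,k-1)...((k+1)/2,(k+3)/2) of {1,...,k},
-- written 0-indexed on Fin k: 0 ↦ 0 and i ↦ k - i for 1 ≤ i ≤ k-1
perm : ∀ k .{{_ : NonZero k}} → Fin k → Fin k
perm k i with toℕ i
... | zero  = i
... | suc _ = (k ℕ.∸ toℕ i) mod k

permMat : ∀ n → (Fin n → Fin n) → Mat n
permMat n π i j = δ (π i) j

P : ∀ k .{{_ : NonZero k}} → Mat k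
P k = permMat k (perm k)

diag₂ : ∀ {m n} → Mat m → Mat n → Mat (m ℕ.+ n)
diag₂ {m} M N i j with splitAt m i | splitAt m j
... | inj₁ a | inj₁ b = M a b
... | inj₂ a | inj₂ b = N a b
... | _      | _      = 0ℤ

Q : ∀ k .{{_ : NonZero k}} → Mat (k ℕ.+ k)
Q k = diag₂ (P k) (I k)

diagR : ∀ n → Mat n → Mat (4 ℕ.+ 4 ℕ.* n)
diagR n M i j with splitAt 4 i | splitAt 4 j
... | inj₁ a | inj₁ b = δ a b
... | inj₂ a | inj₂ b with remQuot {4} n a | remQuot {4} n b
...   | (r , u) | (c , v) = δ r c ℤ.* M u v
diagR n M i j | _ | _ = 0ℤ

R : ∀ k .{{_ : NonZero k}} → Mat (4 ℕ.+ 4 ℕ.* (k ℕ.+ k))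
R k = diagR (k ℕ.+ k) (Q k)

Odd : ℕ → Set
Odd k = ∃[ m ] k ≡ suc (2 ℕ.* m)

-- Inversion ι : g ↦ g⁻¹ is an involutive anti-automorphism of D_{2k}, so
-- ρ(g)_{ι u, ι v} = δ_{u⁻¹g, v⁻¹} = δ_{g⁻¹u, v} = λ(g)_{u,v}: every λ(w) is ρ(w) with rows and
-- columns permuted by ι, i.e. λ(w) = Q ρ(w) Qᵀ, where Q is the permutation matrix of ι.  Since
-- ι sends x^i to x^{-i} and fixes each reflection x^i y, this Q is exactly diag(P, I_k).
-- Simultaneous reindexing of rows and columns by a permutation commutes with sums, products
-- and transposes and fixes I and J, so it carries the system for the ρ-matrices to the
-- system for the λ-matrices and back.  Likewise R = diag(1,1,1,1,Q,Q,Q,Q) is the permutation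
-- matrix of "ι inside each of the four blocks", and reindexing the Kimura template blockwise
-- reindexes each of A, B, C, D.  The two group laws of ι are checked on normal forms x^i y^s
-- with integer exponents, where the multiplication table only needs arithmetic modulo k.
module Submission where

open import Defs
import Algebra.Properties.CommutativeMonoid.Sum as Summation
open import Data.Bool using (Bool; true; false; not; _xor_; if_then_else_)
open import Data.Bool.Properties using (xor-comm)
open import Data.Fin as Fin
  using (Fin; zero; suc; toℕ; fromℕ<; splitAt; join; remQuot; combine; _↑ˡ_; _↑ʳ_)
import Data.Fin.Properties as Fin
open import Data.Fin.Permutation using (Permutation′; permutation; _⟨$⟩ʳ_)
open import Data.Integer as ℤ using (ℤ; +_; -[1+_]; +[1+_]; _%ℕ_; _/ℕ_; 0ℤ; 1ℤ)
open import Data.Integer.DivMod using (a≡a%ℕn+[a/ℕn]*n; n%ℕd<d)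
open import Data.Integer.Divisibility.Signed using (_∣_; divides; ∣m∣n⇒∣m+n; ∣m⇒∣-m)
import Data.Integer.Properties as ℤ
open import Data.Integer.Tactic.RingSolver using (solve-∀)
open import Data.Nat as ℕ using (ℕ; NonZero; _≤_; _%_; _∸_)
open import Data.Nat.DivMod using (_mod_; [m+kn]%n≡m%n; m<n⇒m%n≡m; n%n≡0)
import Data.Nat.Properties as ℕ
open import Data.Product as Product using (_×_; _,_; ∃₂; uncurry)
import Data.Product.Properties as Product
open import Data.Sum as Sum using (_⊎_; inj₁; inj₂)
import Data.Sum.Properties as Sum
open import Function using (Injective; Injection; id; _∘_; case_of_)
open import Function.Bundles using (_⇔_; mk⇔)
open import Function.Properties.Inverse using (↔⇒↣)
open import Relation.Binary.Definitions using (DecidableEquality)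
open import Relation.Binary.PropositionalEquality
open import Relation.Nullary using (Dec; yes; no; contradiction)
open import Relation.Nullary.Decidable using (⌊_⌋)

module Congruence (k : ℕ) .{{_ : NonZero k}} where
  open import Data.Integer using (_+_; _-_; _*_; -_)

  infix 4 _≡ₖ_
  -- A record rather than a synonym for + k ∣ i - j, so that i and j stay inferable.
  record _≡ₖ_ (i j : ℤ) : Set where
    constructor congruent
    field k∣i-j : + k ∣ i - j
  open _≡ₖ_

  private
    transport : ∀ {d i j} → d ≡ i - j → + k ∣ d → i ≡ₖ j
    transport eq p = congruent (subst (+ k ∣_) eq p)

  ≡ₖ-reflexive : ∀ {i j} → i ≡ j → i ≡ₖ j
  ≡ₖ-reflexive {i} refl = congruent (divides 0ℤ (ℤ.+-inverseʳ i))

  ≡ₖ-sym : ∀ {i j} → i ≡ₖ j → j ≡ₖ i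
  ≡ₖ-sym {i} {j} p = transport (identity i j) (∣m⇒∣-m (k∣i-j p))
    where
    identity : ∀ i j → - (i - j) ≡ j - i
    identity = solve-∀

  ≡ₖ-trans : ∀ {i j l} → i ≡ₖ j → j ≡ₖ l → i ≡ₖ l
  ≡ₖ-trans {i} {j} {l} p q = transport (identity i j l) (∣m∣n⇒∣m+n (k∣i-j p) (k∣i-j q))
    where
    identity : ∀ i j l → (i - j) + (j - l) ≡ i - l
    identity = solve-∀

  +-congₖ : ∀ {i i′ j j′} → i ≡ₖ i′ → j ≡ₖ j′ → i + j ≡ₖ i′ + j′
  +-congₖ {i} {i′} {j} {j′} p q = transport (identity i i′ j j′) (∣m∣n⇒∣m+n (k∣i-j p) (k∣i-j q))
    where
    identity : ∀ i i′ j j′ → (i - i′) + (j - j′) ≡ (i + j) - (i′ + j′)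
    identity = solve-∀

  neg-congₖ : ∀ {i j} → i ≡ₖ j → - i ≡ₖ - j
  neg-congₖ {i} {j} p = transport (identity i j) (∣m⇒∣-m (k∣i-j p))
    where
    identity : ∀ i j → - (i - j) ≡ - i - - j
    identity = solve-∀

  +[i%ℕk]≡ₖi : ∀ i → + (i %ℕ k) ≡ₖ i
  +[i%ℕk]≡ₖi i = ≡ₖ-sym (congruent (divides (i /ℕ k) (begin
    i - + (i %ℕ k)                           ≡⟨ cong (_- + (i %ℕ k)) (a≡a%ℕn+[a/ℕn]*n i k) ⟩
    + (i %ℕ k) + i /ℕ k * + k - + (i %ℕ k)   ≡⟨ identity (+ (i %ℕ k)) (i /ℕ k * + k) ⟩
    i /ℕ k * + k                             ∎)))
    where
    open ≡-Reasoning
    identity : ∀ r m → r + m - r ≡ m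
    identity = solve-∀

  +[k∸m]≡ₖ-m : ∀ {m} → m ≤ k → + (k ∸ m) ≡ₖ - + m
  +[k∸m]≡ₖ-m {m} m≤k = congruent (divides (+ 1) (begin
    + (k ∸ m) - - + m  ≡⟨ cong (_- - + m) (ℤ.⊖-≥ m≤k) ⟨
    (k ℤ.⊖ m) - - + m  ≡⟨ cong (_- - + m) (ℤ.m-n≡m⊖n k m) ⟨
    + k - + m - - + m  ≡⟨ identity (+ k) (+ m) ⟩
    + 1 * + k          ∎))
    where
    open ≡-Reasoning
    identity : ∀ K m → K - m - - m ≡ + 1 * K
    identity = solve-∀

  +m≡ₖ+n⇒m%k≡n%k : ∀ {m n} → + m ≡ₖ + n → m % k ≡ n % k
  +m≡ₖ+n⇒m%k≡n%k {m} {n} (congruent (divides (+ q) eq)) = begin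
    m % k               ≡⟨ cong (_% k) (ℤ.+-injective (begin
      + m                   ≡⟨ identity (+ m) (+ n) ⟩
      + n + (+ m - + n)     ≡⟨ cong (ℤ._+_ (+ n)) eq ⟩
      + n + + q * + k       ≡⟨ cong (ℤ._+_ (+ n)) (ℤ.pos-* q k) ⟨
      + n + + (q ℕ.* k)     ≡⟨ ℤ.pos-+ n (q ℕ.* k) ⟨
      + (n ℕ.+ q ℕ.* k)     ∎)) ⟩
    (n ℕ.+ q ℕ.* k) % k ≡⟨ [m+kn]%n≡m%n n q k ⟩
    n % k               ∎
    where
    open ≡-Reasoning
    identity : ∀ m n → m ≡ n + (m - n)
    identity = solve-∀
  +m≡ₖ+n⇒m%k≡n%k {m} {n} (congruent (divides -[1+ q ] eq)) =
    sym (+m≡ₖ+n⇒m%k≡n%k {n} {m} (congruent (divides +[1+ q ] (begin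
      + n - + m             ≡⟨ identity (+ m) (+ n) ⟩
      - (+ m - + n)         ≡⟨ cong -_ eq ⟩
      - (-[1+ q ] * + k)    ≡⟨ ℤ.neg-distribˡ-* -[1+ q ] (+ k) ⟩
      +[1+ q ] * + k        ∎))))
    where
    open ≡-Reasoning
    identity : ∀ m n → n - m ≡ - (m - n)
    identity = solve-∀

module DihedralGroup (k : ℕ) .{{_ : NonZero k}} where
  open import Data.Integer using (_+_; _-_; -_)
  open Dihedral k
  open Congruence k

  ℤmod : ℤ → Fin k
  ℤmod i = fromℕ< (n%ℕd<d i k)

  infix 25 x^_y^_
  x^_y^_ : ℤ → Bool → G
  x^ i y^ false = join k k (inj₁ (ℤmod i))
  x^ i y^ true  = join k k (inj₂ (ℤmod i))

  twist : Bool → ℤ → ℤ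
  twist false i = i
  twist true  i = - i

  ℤmod-cong : ∀ {i j} → i ≡ₖ j → ℤmod i ≡ ℤmod j
  ℤmod-cong {i} {j} p = Fin.toℕ-injective (begin
    toℕ (ℤmod i)  ≡⟨ Fin.toℕ-fromℕ< _ ⟩
    i %ℕ k        ≡⟨ m<n⇒m%n≡m (n%ℕd<d i k) ⟨
    i %ℕ k % k    ≡⟨ +m≡ₖ+n⇒m%k≡n%k (≡ₖ-trans (+[i%ℕk]≡ₖi i) (≡ₖ-trans p (≡ₖ-sym (+[i%ℕk]≡ₖi j)))) ⟩
    j %ℕ k % k    ≡⟨ m<n⇒m%n≡m (n%ℕd<d j k) ⟩
    j %ℕ k        ≡⟨ Fin.toℕ-fromℕ< _ ⟨
    toℕ (ℤmod j)  ∎)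
    where open ≡-Reasoning

  ℤmod-toℕ : ∀ a → ℤmod (+ toℕ a) ≡ a
  ℤmod-toℕ a = Fin.toℕ-injective (trans (Fin.toℕ-fromℕ< _) (m<n⇒m%n≡m (Fin.toℕ<n a)))

  +toℕ-ℤmod : ∀ i → + toℕ (ℤmod i) ≡ₖ i
  +toℕ-ℤmod i = ≡ₖ-trans (≡ₖ-reflexive (cong +_ (Fin.toℕ-fromℕ< _))) (+[i%ℕk]≡ₖi i)

  x^y^-cong : ∀ {i j} s → i ≡ₖ j → x^ i y^ s ≡ x^ j y^ s
  x^y^-cong false p = cong (λ a → join k k (inj₁ a)) (ℤmod-cong p)
  x^y^-cong true  p = cong (λ a → join k k (inj₂ a)) (ℤmod-cong p)

  private
    exponent-+ : ∀ i j → + (toℕ (ℤmod i) ℕ.+ toℕ (ℤmod j)) ≡ₖ i + j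
    exponent-+ i j = ≡ₖ-trans (≡ₖ-reflexive (ℤ.pos-+ (toℕ (ℤmod i)) (toℕ (ℤmod j))))
                              (+-congₖ (+toℕ-ℤmod i) (+toℕ-ℤmod j))

    exponent-neg : ∀ i → + (k ∸ toℕ (ℤmod i)) ≡ₖ - i
    exponent-neg i = ≡ₖ-trans (+[k∸m]≡ₖ-m (ℕ.<⇒≤ (Fin.toℕ<n (ℤmod i)))) (neg-congₖ (+toℕ-ℤmod i))

    exponent-- : ∀ i j → + (toℕ (ℤmod i) ℕ.+ (k ∸ toℕ (ℤmod j))) ≡ₖ i - j
    exponent-- i j = ≡ₖ-trans (≡ₖ-reflexive (ℤ.pos-+ (toℕ (ℤmod i)) (k ∸ toℕ (ℤmod j))))
                              (+-congₖ (+toℕ-ℤmod i) (exponent-neg j))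

  private
    splitAt-x^ : ∀ i → splitAt k (x^ i y^ false) ≡ inj₁ (ℤmod i)
    splitAt-x^ i = Fin.splitAt-join k k (inj₁ (ℤmod i))

    splitAt-x^y : ∀ i → splitAt k (x^ i y^ true) ≡ inj₂ (ℤmod i)
    splitAt-x^y i = Fin.splitAt-join k k (inj₂ (ℤmod i))

  x^y^-∙ : ∀ i s j t → x^ i y^ s ∙ x^ j y^ t ≡ x^ (i + twist s j) y^ (s xor t)
  x^y^-∙ i false j false rewrite splitAt-x^  i | splitAt-x^  j = x^y^-cong false (exponent-+ i j)
  x^y^-∙ i false j true  rewrite splitAt-x^  i | splitAt-x^y j = x^y^-cong true  (exponent-+ i j)
  x^y^-∙ i true  j false rewrite splitAt-x^y i | splitAt-x^  j = x^y^-cong true  (exponent-- i j)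
  x^y^-∙ i true  j true  rewrite splitAt-x^y i | splitAt-x^y j = x^y^-cong false (exponent-- i j)

  x^y^-inv : ∀ i s → inv (x^ i y^ s) ≡ x^ (twist (not s) i) y^ s
  x^y^-inv i false rewrite splitAt-x^  i = x^y^-cong false (exponent-neg i)
  x^y^-inv i true  rewrite splitAt-x^y i = refl

  x^y^-surjective : ∀ g → ∃₂ λ i s → g ≡ x^ i y^ s
  x^y^-surjective g with splitAt k g in eq
  ... | inj₁ a = + toℕ a , false , trans (sym (Fin.splitAt⁻¹-↑ˡ eq)) (cong (_↑ˡ k) (sym (ℤmod-toℕ a)))
  ... | inj₂ a = + toℕ a , true  , trans (sym (Fin.splitAt⁻¹-↑ʳ eq)) (cong (k ↑ʳ_) (sym (ℤmod-toℕ a)))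

  twist-involutive : ∀ s i → twist s (twist s i) ≡ i
  twist-involutive false i = refl
  twist-involutive true  i = ℤ.neg-involutive i

  inv-involutive : ∀ g → inv (inv g) ≡ g
  inv-involutive g with x^y^-surjective g
  ... | i , s , refl = begin
    inv (inv (x^ i y^ s))                     ≡⟨ cong inv (x^y^-inv i s) ⟩
    inv (x^ twist (not s) i y^ s)             ≡⟨ x^y^-inv _ s ⟩
    x^ twist (not s) (twist (not s) i) y^ s   ≡⟨ cong (x^_y^ s) (twist-involutive (not s) i) ⟩
    x^ i y^ s                                 ∎
    where open ≡-Reasoning

  inv-injective : Injective _≡_ _≡_ inv
  inv-injective {g} {h} e = trans (sym (inv-involutive g)) (trans (cong inv e) (inv-involutive h))

  private
    exponent-anti : ∀ s t i j →
      twist (not (s xor t)) (i + twist s j) ≡ twist (not t) j + twist t (twist (not s) i)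
    exponent-anti false false = identity
      where identity : ∀ i j → - (i + j) ≡ - j + - i
            identity = solve-∀
    exponent-anti false true  = identity
      where identity : ∀ i j → i + j ≡ j + - - i
            identity = solve-∀
    exponent-anti true  false = identity
      where identity : ∀ i j → i + - j ≡ - j + i
            identity = solve-∀
    exponent-anti true  true  = identity
      where identity : ∀ i j → - (i + - j) ≡ j + - i
            identity = solve-∀

  inv-anti-homo-∙ : ∀ g h → inv (g ∙ h) ≡ inv h ∙ inv g
  inv-anti-homo-∙ g h with x^y^-surjective g | x^y^-surjective h
  ... | i , s , refl | j , t , refl = begin
    inv (x^ i y^ s ∙ x^ j y^ t)                                   ≡⟨ cong inv (x^y^-∙ i s j t) ⟩
    inv (x^ (i + twist s j) y^ (s xor t))                         ≡⟨ x^y^-inv (i + twist s j) (s xor t) ⟩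
    x^ twist (not (s xor t)) (i + twist s j) y^ (s xor t)         ≡⟨ cong₂ x^_y^_ (exponent-anti s t i j) (xor-comm s t) ⟩
    x^ (twist (not t) j + twist t (twist (not s) i)) y^ (t xor s) ≡⟨ x^y^-∙ _ t _ s ⟨
    x^ twist (not t) j y^ t ∙ x^ twist (not s) i y^ s             ≡⟨ cong₂ _∙_ (x^y^-inv j t) (x^y^-inv i s) ⟨
    inv (x^ j y^ t) ∙ inv (x^ i y^ s)                             ∎
    where open ≡-Reasoning

module Matrices where
  open import Data.Integer using (_+_; _-_; _*_)

  δ[_] : ∀ {A : Set} → DecidableEquality A → A → A → ℤ
  δ[ _≟_ ] a b = if ⌊ a ≟ b ⌋ then 1ℤ else 0ℤ

  module _ {A : Set} (_≟_ : DecidableEquality A) where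

    δ-≡ : ∀ {a b} → a ≡ b → δ[ _≟_ ] a b ≡ 1ℤ
    δ-≡ {a} {b} a≡b with a ≟ b
    ... | yes _   = refl
    ... | no a≢b  = contradiction a≡b a≢b

    δ-≢ : ∀ {a b} → a ≢ b → δ[ _≟_ ] a b ≡ 0ℤ
    δ-≢ {a} {b} a≢b with a ≟ b
    ... | yes a≡b = contradiction a≡b a≢b
    ... | no _    = refl

  δ-injective : ∀ {A B : Set} (_≟ᴬ_ : DecidableEquality A) (_≟ᴮ_ : DecidableEquality B) {f : A → B} →
                Injective _≡_ _≡_ f → ∀ a b → δ[ _≟ᴮ_ ] (f a) (f b) ≡ δ[ _≟ᴬ_ ] a b
  δ-injective _≟ᴬ_ _≟ᴮ_ {f} f-inj a b with a ≟ᴬ b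
  ... | yes a≡b = δ-≡ _≟ᴮ_ (cong f a≡b)
  ... | no a≢b  = δ-≢ _≟ᴮ_ (a≢b ∘ f-inj)

  δ-× : ∀ {A B : Set} (_≟ᴬ_ : DecidableEquality A) (_≟ᴮ_ : DecidableEquality B) (a c : A) (b d : B) →
        δ[ Product.≡-dec _≟ᴬ_ _≟ᴮ_ ] (a , b) (c , d) ≡ δ[ _≟ᴬ_ ] a c * δ[ _≟ᴮ_ ] b d
  δ-× _≟ᴬ_ _≟ᴮ_ a c b d = by-cases (a ≟ᴬ c) (b ≟ᴮ d)
    where
    _≟_ = Product.≡-dec _≟ᴬ_ _≟ᴮ_
    by-cases : Dec (a ≡ c) → Dec (b ≡ d) → δ[ _≟_ ] (a , b) (c , d) ≡ δ[ _≟ᴬ_ ] a c * δ[ _≟ᴮ_ ] b d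
    by-cases (yes a≡c) (yes b≡d) = trans (δ-≡ _≟_ (cong₂ _,_ a≡c b≡d))
                                         (sym (cong₂ _*_ (δ-≡ _≟ᴬ_ a≡c) (δ-≡ _≟ᴮ_ b≡d)))
    by-cases (yes _)   (no b≢d)  = trans (δ-≢ _≟_ (b≢d ∘ Product.,-injectiveʳ))
                                         (sym (trans (cong (δ[ _≟ᴬ_ ] a c *_) (δ-≢ _≟ᴮ_ b≢d))
                                                     (ℤ.*-zeroʳ (δ[ _≟ᴬ_ ] a c))))
    by-cases (no a≢c)  _         = trans (δ-≢ _≟_ (a≢c ∘ Product.,-injectiveˡ))
                                         (sym (cong (_* δ[ _≟ᴮ_ ] b d) (δ-≢ _≟ᴬ_ a≢c)))

  ∑-cong : ∀ n {f g : Fin n → ℤ} → (∀ i → f i ≡ g i) → ∑ n f ≡ ∑ n g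
  ∑-cong ℕ.zero    f≗g = refl
  ∑-cong (ℕ.suc n) f≗g = cong₂ _+_ (f≗g zero) (∑-cong n (f≗g ∘ suc))

  ∑-δˡ : ∀ n (a : Fin n) (f : Fin n → ℤ) → ∑ n (λ l → δ a l * f l) ≡ f a
  ∑-δˡ (ℕ.suc n) zero f = begin
    1ℤ * f zero + ∑ n (λ l → 0ℤ * f (suc l))   ≡⟨ cong₂ _+_ (ℤ.*-identityˡ (f zero)) (∑-zero n (f ∘ suc)) ⟩
    f zero + 0ℤ                                 ≡⟨ ℤ.+-identityʳ (f zero) ⟩
    f zero                                      ∎
    where
    open ≡-Reasoning
    ∑-zero : ∀ n (g : Fin n → ℤ) → ∑ n (λ l → 0ℤ * g l) ≡ 0ℤ
    ∑-zero ℕ.zero    g = refl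
    ∑-zero (ℕ.suc n) g = cong₂ _+_ (ℤ.*-zeroˡ (g zero)) (∑-zero n (g ∘ suc))
  ∑-δˡ (ℕ.suc n) (suc a) f = begin
    0ℤ * f zero + ∑ n (λ l → δ (suc a) (suc l) * f (suc l))
      ≡⟨ cong₂ _+_ (ℤ.*-zeroˡ (f zero)) (∑-cong n (λ l → cong (_* f (suc l)) (δ-suc l))) ⟩
    0ℤ + ∑ n (λ l → δ a l * f (suc l))            ≡⟨ ℤ.+-identityˡ _ ⟩
    ∑ n (λ l → δ a l * f (suc l))                 ≡⟨ ∑-δˡ n a (f ∘ suc) ⟩
    f (suc a)                                     ∎
    where
    open ≡-Reasoning
    -- Not by refl: Fin's _≟_ goes through Dec.map′, on which ⌊_⌋ does not compute.
    δ-suc : ∀ l → δ (suc a) (suc l) ≡ δ a l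
    δ-suc = δ-injective Fin._≟_ Fin._≟_ Fin.suc-injective a

  ∑-δʳ : ∀ n (a : Fin n) (f : Fin n → ℤ) → ∑ n (λ l → f l * δ a l) ≡ f a
  ∑-δʳ n a f = trans (∑-cong n (λ l → ℤ.*-comm (f l) (δ a l))) (∑-δˡ n a f)

  ∑-permute : ∀ n (f : Fin n → ℤ) (π : Permutation′ n) → ∑ n f ≡ ∑ n (f ∘ (π ⟨$⟩ʳ_))
  ∑-permute n f π = begin
    ∑ n f                          ≡⟨ ∑≡sum n f ⟩
    ℤSum.sum f                        ≡⟨ ℤSum.sum-permute f π ⟩
    ℤSum.sum (f ∘ (π ⟨$⟩ʳ_))          ≡⟨ ∑≡sum n (f ∘ (π ⟨$⟩ʳ_)) ⟨
    ∑ n (f ∘ (π ⟨$⟩ʳ_))            ∎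
    where
    open ≡-Reasoning
    module ℤSum = Summation ℤ.+-0-commutativeMonoid
    ∑≡sum : ∀ n (f : Fin n → ℤ) → ∑ n f ≡ ℤSum.sum f
    ∑≡sum ℕ.zero    f = refl
    ∑≡sum (ℕ.suc n) f = cong (_+_ (f zero)) (∑≡sum n (f ∘ suc))

  reindex : ∀ {n} → (Fin n → Fin n) → Mat n → Mat n
  reindex σ M i j = M (σ i) (σ j)

  module _ {n : ℕ} where

    ≈-sym : {L M : Mat n} → L ≈ M → M ≈ L
    ≈-sym p i j = sym (p i j)

    ≈-trans : {L M N : Mat n} → L ≈ M → M ≈ N → L ≈ N
    ≈-trans p q i j = trans (p i j) (q i j)

    ⊕-cong : {L L′ M M′ : Mat n} → L ≈ L′ → M ≈ M′ → L ⊕ M ≈ L′ ⊕ M′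
    ⊕-cong p q i j = cong₂ _+_ (p i j) (q i j)

    ⊖-cong : {L L′ M M′ : Mat n} → L ≈ L′ → M ≈ M′ → L ⊖ M ≈ L′ ⊖ M′
    ⊖-cong p q i j = cong₂ _-_ (p i j) (q i j)

    ⊛-cong : ∀ c {L M : Mat n} → L ≈ M → c ⊛ L ≈ c ⊛ M
    ⊛-cong c p i j = cong (c *_) (p i j)

    ·-cong : {L L′ M M′ : Mat n} → L ≈ L′ → M ≈ M′ → L · M ≈ L′ · M′
    ·-cong p q i j = ∑-cong n (λ l → cong₂ _*_ (p i l) (q l j))

    ᵀ-cong : {L M : Mat n} → L ≈ M → L ᵀ ≈ M ᵀ
    ᵀ-cong p i j = p j i

    reindex-cong : ∀ σ {L M : Mat n} → L ≈ M → reindex σ L ≈ reindex σ M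
    reindex-cong σ p i j = p (σ i) (σ j)

    reindex-involution : ∀ {σ} → (∀ i → σ (σ i) ≡ i) → {L M : Mat n} → L ≈ reindex σ M → M ≈ reindex σ L
    reindex-involution {σ} σσ {L} {M} p i j = trans (sym (cong₂ M (σσ i) (σσ j))) (sym (p (σ i) (σ j)))

    reindex-I : ∀ {σ} → Injective _≡_ _≡_ σ → reindex σ (I n) ≈ I n
    reindex-I σ-inj = δ-injective Fin._≟_ Fin._≟_ σ-inj

    reindex-· : ∀ (π : Permutation′ n) (L M : Mat n) →
                reindex (π ⟨$⟩ʳ_) (L · M) ≈ reindex (π ⟨$⟩ʳ_) L · reindex (π ⟨$⟩ʳ_) M
    reindex-· π L M i j = ∑-permute n (λ l → L (π ⟨$⟩ʳ i) l * M l (π ⟨$⟩ʳ j)) π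

    permMat-cong : ∀ {σ τ} → (∀ i → σ i ≡ τ i) → permMat n σ ≈ permMat n τ
    permMat-cong σ≗τ i j = cong (λ a → δ a j) (σ≗τ i)

    permMat-conj : ∀ {P τ} → P ≈ permMat n τ → ∀ H → P · H · P ᵀ ≈ reindex τ H
    permMat-conj {P} {τ} P≈ H i j = begin
      ∑ n (λ m → (P · H) i m * P j m)     ≡⟨ ∑-cong n (λ m → cong₂ _*_ (PH≈ i m) (P≈ j m)) ⟩
      ∑ n (λ m → H (τ i) m * δ (τ j) m)   ≡⟨ ∑-δʳ n (τ j) (H (τ i)) ⟩
      H (τ i) (τ j)                       ∎
      where
      open ≡-Reasoning
      PH≈ : ∀ i m → (P · H) i m ≡ H (τ i) m
      PH≈ i m = trans (∑-cong n (λ l → cong (_* H l m) (P≈ i l))) (∑-δˡ n (τ i) (λ l → H l m))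

  gram-reindex : ∀ {n} (π : Permutation′ n) (L M : Mat n) {L′ M′ : Mat n} →
                 L′ ≈ reindex (π ⟨$⟩ʳ_) L → M′ ≈ reindex (π ⟨$⟩ʳ_) M →
                 L′ · M′ ᵀ ≈ reindex (π ⟨$⟩ʳ_) (L · M ᵀ)
  gram-reindex π L M p q = ≈-trans (·-cong p (ᵀ-cong q)) (≈-sym (reindex-· π L (M ᵀ)))

  System-reindex : ∀ k (π : Permutation′ (k ℕ.+ k)) (A B C D : Mat (k ℕ.+ k))
                   {A′ B′ C′ D′ : Mat (k ℕ.+ k)} → let σ = π ⟨$⟩ʳ_ in
    A′ ≈ reindex σ A → B′ ≈ reindex σ B → C′ ≈ reindex σ C → D′ ≈ reindex σ D →
    System k A B C D → System k A′ B′ C′ D′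
  System-reindex k π A B C D a b c d (e₁ , e₂ , e₃ , e₄) =
      ≈-trans (⊕-cong (⊕-cong (⊕-cong (g A A a a) (g B B b b)) (g C C c c)) (g D D d d))
              (≈-trans (reindex-cong σ e₁) (⊖-cong (⊛-cong (+ (8 ℕ.* k ℕ.+ 4)) (reindex-I σ-injective)) J≈))
    , ≈-trans (⊖-cong (⊕-cong (⊕-cong (⊖-cong 0≈ (g A B a b)) (g B A b a)) (g C D c d)) (g D C d c)) (reindex-cong σ e₂)
    , ≈-trans (⊕-cong (⊕-cong (⊖-cong (⊖-cong 0≈ (g A C a c)) (g B D b d)) (g C A c a)) (g D B d b)) (reindex-cong σ e₃)
    , ≈-trans (⊖-cong (⊕-cong (⊖-cong (g A D a d) (g B C b c)) (g C B c b)) (g D A d a)) (reindex-cong σ e₄)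
    where
    σ = π ⟨$⟩ʳ_
    σ-injective : Injective _≡_ _≡_ σ
    σ-injective = Injection.injective (↔⇒↣ π)
    g = gram-reindex π
    0≈ : Zero (k ℕ.+ k) ≈ reindex σ (Zero (k ℕ.+ k))
    0≈ _ _ = refl
    J≈ : reindex σ ((+ 4) ⊛ Jm (k ℕ.+ k)) ≈ (+ 4) ⊛ Jm (k ℕ.+ k)
    J≈ _ _ = refl

  diag₂-permMat : ∀ {m n} (π : Fin m → Fin m) (π′ : Fin n → Fin n) →
    diag₂ (permMat m π) (permMat n π′) ≈ permMat (m ℕ.+ n) (join m n ∘ Sum.map π π′ ∘ splitAt m)
  diag₂-permMat {m} {n} π π′ i j with splitAt m i | splitAt m j in eq
  ... | inj₁ a | inj₁ b = trans (sym (δ-injective Fin._≟_ Fin._≟_ (Fin.↑ˡ-injective n _ _) (π a) b))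
                                (cong (δ (π a ↑ˡ n)) (Fin.splitAt⁻¹-↑ˡ eq))
  ... | inj₂ a | inj₂ b = trans (sym (δ-injective Fin._≟_ Fin._≟_ (Fin.↑ʳ-injective m _ _) (π′ a) b))
                                (cong (δ (m ↑ʳ π′ a)) (Fin.splitAt⁻¹-↑ʳ eq))
  ... | inj₁ a | inj₂ b = sym (δ-≢ Fin._≟_ λ e →
    case trans (sym (Fin.splitAt-↑ˡ m (π a) n)) (trans (cong (splitAt m) e) eq) of λ ())
  ... | inj₂ a | inj₁ b = sym (δ-≢ Fin._≟_ λ e →
    case trans (sym (Fin.splitAt-↑ʳ m n (π′ a))) (trans (cong (splitAt m) e) eq) of λ ())

open Matrices

module Blocks (n : ℕ) where
  open import Data.Integer using (_*_)

  -- An index of a (4 + 4n)-square matrix is one of the four border indices, or a block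
  -- number together with an offset inside that block.
  Position : Set
  Position = Fin 4 ⊎ (Fin 4 × Fin n)

  _≟ₚ_ : DecidableEquality Position
  _≟ₚ_ = Sum.≡-dec Fin._≟_ (Product.≡-dec Fin._≟_ Fin._≟_)

  position : Fin (4 ℕ.+ 4 ℕ.* n) → Position
  position i = Sum.map₂ (remQuot n) (splitAt 4 i)

  index : Position → Fin (4 ℕ.+ 4 ℕ.* n)
  index p = join 4 (4 ℕ.* n) (Sum.map₂ (uncurry combine) p)

  position-index : ∀ p → position (index p) ≡ p
  position-index (inj₁ a)       = cong (Sum.map₂ (remQuot n)) (Fin.splitAt-↑ˡ 4 a (4 ℕ.* n))
  position-index (inj₂ (r , u)) = trans (cong (Sum.map₂ (remQuot n)) (Fin.splitAt-↑ʳ 4 (4 ℕ.* n) (combine r u)))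
                                        (cong inj₂ (Fin.remQuot-combine r u))

  index-position : ∀ i → index (position i) ≡ i
  index-position i with splitAt 4 i in eq
  ... | inj₁ a = Fin.splitAt⁻¹-↑ˡ eq
  ... | inj₂ b = trans (cong (4 ↑ʳ_) (Fin.combine-remQuot {4} n b)) (Fin.splitAt⁻¹-↑ʳ eq)

  δ-index : ∀ p q → δ (index p) (index q) ≡ δ[ _≟ₚ_ ] p q
  δ-index = δ-injective _≟ₚ_ Fin._≟_ λ {p} {q} e →
    trans (sym (position-index p)) (trans (cong position e) (position-index q))

  private
    lift : (Fin n → Fin n) → Position → Position
    lift σ = Sum.map₂ (Product.map₂ σ)

  inBlocks : (Fin n → Fin n) → Fin (4 ℕ.+ 4 ℕ.* n) → Fin (4 ℕ.+ 4 ℕ.* n)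
  inBlocks σ i = index (lift σ (position i))

  diagRᵖ : Mat n → Position → Position → ℤ
  diagRᵖ M (inj₁ a)       (inj₁ b)       = δ a b
  diagRᵖ M (inj₂ (r , u)) (inj₂ (c , v)) = δ r c * M u v
  diagRᵖ M _              _              = 0ℤ

  diagR-position : ∀ M i j → diagR n M i j ≡ diagRᵖ M (position i) (position j)
  diagR-position M i j with splitAt 4 i | splitAt 4 j
  ... | inj₁ a | inj₁ b = refl
  ... | inj₁ a | inj₂ b = refl
  ... | inj₂ a | inj₁ b = refl
  ... | inj₂ a | inj₂ b = refl

  diagRᵖ-permMat : ∀ {M π} → M ≈ permMat n π → ∀ p q → diagRᵖ M p q ≡ δ[ _≟ₚ_ ] (lift π p) q
  diagRᵖ-permMat M≈ (inj₁ a) (inj₁ b) = sym (δ-injective Fin._≟_ _≟ₚ_ Sum.inj₁-injective a b)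
  diagRᵖ-permMat {M} {π} M≈ (inj₂ (r , u)) (inj₂ (c , v)) = sym (begin
    δ[ _≟ₚ_ ] (inj₂ (r , π u)) (inj₂ (c , v))             ≡⟨ δ-injective _≟²_ _≟ₚ_ Sum.inj₂-injective _ _ ⟩
    δ[ _≟²_ ] (r , π u) (c , v)                            ≡⟨ δ-× Fin._≟_ Fin._≟_ r c (π u) v ⟩
    δ r c * δ (π u) v                                      ≡⟨ cong (δ r c *_) (M≈ u v) ⟨
    δ r c * M u v                                          ∎)
    where
    open ≡-Reasoning
    _≟²_ = Product.≡-dec Fin._≟_ Fin._≟_
  diagRᵖ-permMat M≈ (inj₁ _) (inj₂ _) = refl
  diagRᵖ-permMat M≈ (inj₂ _) (inj₁ _) = refl

  diagR-permMat : ∀ {M} π → M ≈ permMat n π → diagR n M ≈ permMat (4 ℕ.+ 4 ℕ.* n) (inBlocks π)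
  diagR-permMat {M} π M≈ i j = begin
    diagR n M i j                                  ≡⟨ diagR-position M i j ⟩
    diagRᵖ M (position i) (position j)             ≡⟨ diagRᵖ-permMat M≈ (position i) (position j) ⟩
    δ[ _≟ₚ_ ] (lift π (position i)) (position j)    ≡⟨ δ-index _ (position j) ⟨
    δ (inBlocks π i) (index (position j))          ≡⟨ cong (δ (inBlocks π i)) (index-position j) ⟩
    δ (inBlocks π i) j                             ∎
    where open ≡-Reasoning

  kimuraᵖ : (A B C D : Mat n) → Position → Position → ℤ
  kimuraᵖ A B C D (inj₁ r)       (inj₁ c)       = T₀ ! r ! c
  kimuraᵖ A B C D (inj₁ r)       (inj₂ (c , _)) = T₁ ! r ! c
  kimuraᵖ A B C D (inj₂ (r , _)) (inj₁ c)       = T₂ ! r ! c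
  kimuraᵖ A B C D (inj₂ (r , u)) (inj₂ (c , v)) = T₃ ! r ! c * pick A B C D (Blk ! r ! c) u v

  kimura-position : ∀ A B C D i j → kimura n A B C D i j ≡ kimuraᵖ A B C D (position i) (position j)
  kimura-position A B C D i j with splitAt 4 i | splitAt 4 j
  ... | inj₁ a | inj₁ b = refl
  ... | inj₁ a | inj₂ b = refl
  ... | inj₂ a | inj₁ b = refl
  ... | inj₂ a | inj₂ b = refl

  module _ (σ : Fin n → Fin n) (A B C D : Mat n) {A′ B′ C′ D′ : Mat n}
           (a : A′ ≈ reindex σ A) (b : B′ ≈ reindex σ B) (c : C′ ≈ reindex σ C) (d : D′ ≈ reindex σ D) where

    pick-reindex : ∀ f → pick A′ B′ C′ D′ f ≈ reindex σ (pick A B C D f)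
    pick-reindex zero                   = a
    pick-reindex (suc zero)             = b
    pick-reindex (suc (suc zero))       = c
    pick-reindex (suc (suc (suc zero))) = d

    kimuraᵖ-reindex : ∀ p q → kimuraᵖ A′ B′ C′ D′ p q ≡ kimuraᵖ A B C D (lift σ p) (lift σ q)
    kimuraᵖ-reindex (inj₁ _)       (inj₁ _)       = refl
    kimuraᵖ-reindex (inj₁ _)       (inj₂ _)       = refl
    kimuraᵖ-reindex (inj₂ _)       (inj₁ _)       = refl
    kimuraᵖ-reindex (inj₂ (r , u)) (inj₂ (c , v)) = cong (T₃ ! r ! c *_) (pick-reindex (Blk ! r ! c) u v)

    kimura-reindex : kimura n A′ B′ C′ D′ ≈ reindex (inBlocks σ) (kimura n A B C D)
    kimura-reindex i j = begin
      kimura n A′ B′ C′ D′ i j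
        ≡⟨ kimura-position A′ B′ C′ D′ i j ⟩
      kimuraᵖ A′ B′ C′ D′ (position i) (position j)
        ≡⟨ kimuraᵖ-reindex (position i) (position j) ⟩
      kimuraᵖ A B C D (lift σ (position i)) (lift σ (position j))
        ≡⟨ cong₂ (kimuraᵖ A B C D) (position-index (lift σ (position i))) (position-index (lift σ (position j))) ⟨
      kimuraᵖ A B C D (position (inBlocks σ i)) (position (inBlocks σ j))
        ≡⟨ kimura-position A B C D (inBlocks σ i) (inBlocks σ j) ⟨
      kimura n A B C D (inBlocks σ i) (inBlocks σ j)
        ∎
      where open ≡-Reasoning

module Representations (k : ℕ) .{{_ : NonZero k}} where
  open import Data.Integer using (_*_)
  open Dihedral k
  open DihedralGroup k using (inv-involutive; inv-injective; inv-anti-homo-∙)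

  inv-permutation : Permutation′ (k ℕ.+ k)
  inv-permutation = permutation inv inv inv-involutive inv-involutive

  λ'-reindex : ∀ g → λ' g ≈ reindex inv (ρ g)
  λ'-reindex g u v = begin
    δ (inv g ∙ u) v                ≡⟨ δ-injective Fin._≟_ Fin._≟_ inv-injective (inv g ∙ u) v ⟨
    δ (inv (inv g ∙ u)) (inv v)    ≡⟨ cong (λ h → δ h (inv v)) (inv-anti-homo-∙ (inv g) u) ⟩
    δ (inv u ∙ inv (inv g)) (inv v) ≡⟨ cong (λ h → δ (inv u ∙ h) (inv v)) (inv-involutive g) ⟩
    δ (inv u ∙ g) (inv v)          ∎
    where open ≡-Reasoning

  λZ-reindex : ∀ w → λZ w ≈ reindex inv (ρZ w)
  λZ-reindex w u v = ∑-cong (k ℕ.+ k) (λ g → cong (w g *_) (λ'-reindex g u v))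

  perm-mod : ∀ a → perm k a ≡ (k ∸ toℕ a) mod k
  perm-mod a with toℕ a in eq
  ... | ℕ.zero  = Fin.toℕ-injective (trans eq (sym (trans (Fin.toℕ-fromℕ< _) (n%n≡0 k))))
  ... | ℕ.suc _ = cong (λ t → (k ∸ t) mod k) eq

  inv-splitAt : ∀ g → join k k (Sum.map (perm k) id (splitAt k g)) ≡ inv g
  inv-splitAt g with splitAt k g in eq
  ... | inj₁ a = cong (λ b → join k k (inj₁ b)) (perm-mod a)
  ... | inj₂ a = Fin.splitAt⁻¹-↑ʳ eq

  Q≈permMat : Q k ≈ permMat (k ℕ.+ k) inv
  Q≈permMat = ≈-trans (diag₂-permMat (perm k) id) (permMat-cong inv-splitAt)

  R≈permMat : R k ≈ permMat (4 ℕ.+ 4 ℕ.* (k ℕ.+ k)) (Blocks.inBlocks (k ℕ.+ k) inv)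
  R≈permMat = Blocks.diagR-permMat (k ℕ.+ k) inv Q≈permMat

open import Data.Nat using (_+_)

-- The hypotheses "k ≥ 3 odd" and "coefficients in {0, 1}" are not needed.
lemma2p1 : (k : ℕ) .{{_ : NonZero k}} → 3 ≤ k → Odd k →
    (a b c d : Dihedral.ZG k) →
    (∀ g → a g ≡ 0ℤ ⊎ a g ≡ 1ℤ) → (∀ g → b g ≡ 0ℤ ⊎ b g ≡ 1ℤ) →
    (∀ g → c g ≡ 0ℤ ⊎ c g ≡ 1ℤ) → (∀ g → d g ≡ 0ℤ ⊎ d g ≡ 1ℤ) →
    let n = k + k
        Wρ = λ (w : Dihedral.ZG k) → (+ 2) ⊛ Dihedral.ρZ k w ⊖ Jm n
        Wλ = λ (w : Dihedral.ZG k) → (+ 2) ⊛ Dihedral.λZ k w ⊖ Jm n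
        H₁ = kimura n (Wρ a) (Wρ b) (Wρ c) (Wρ d)
        H₂ = kimura n (Wλ a) (Wλ b) (Wλ c) (Wλ d)
    in (System k (Wρ a) (Wρ b) (Wρ c) (Wρ d) ⇔ System k (Wλ a) (Wλ b) (Wλ c) (Wλ d))
       × (R k · H₁ · R k ᵀ ≈ H₂)
lemma2p1 k _ _ a b c d _ _ _ _ =
    mk⇔ (System-reindex k ι (Wρ a) (Wρ b) (Wρ c) (Wρ d) (Wλ≈ a) (Wλ≈ b) (Wλ≈ c) (Wλ≈ d))
        (System-reindex k ι (Wλ a) (Wλ b) (Wλ c) (Wλ d) (Wρ≈ a) (Wρ≈ b) (Wρ≈ c) (Wρ≈ d))
  , ≈-trans (permMat-conj R≈permMat H₁)
            (≈-sym (Blocks.kimura-reindex n inv (Wρ a) (Wρ b) (Wρ c) (Wρ d) (Wλ≈ a) (Wλ≈ b) (Wλ≈ c) (Wλ≈ d)))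
  where
  open Dihedral k
  open DihedralGroup k using (inv-involutive)
  open Representations k
  n = k + k
  ι = inv-permutation
  Wρ Wλ : ZG → Mat n
  Wρ w = (+ 2) ⊛ ρZ w ⊖ Jm n
  Wλ w = (+ 2) ⊛ λZ w ⊖ Jm n
  H₁ = kimura n (Wρ a) (Wρ b) (Wρ c) (Wρ d)
  Wλ≈ : ∀ w → Wλ w ≈ reindex inv (Wρ w)
  Wλ≈ w = ⊖-cong (⊛-cong (+ 2) (λZ-reindex w)) (λ _ _ → refl)
  Wρ≈ : ∀ w → Wρ w ≈ reindex inv (Wλ w)
  Wρ≈ w = reindex-involution inv-involutive (Wλ≈ w)
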